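{- For any graph $G$ of order $n$, $n\leqslant \chi_{\square}(G)\chi_{\square}(\overline{G})\leqslant n^2$; equivalently, $n\leqslant \chi(G^2)\chi(\overline{G}^2)\leqslant n^2$.
   Context: All graphs are finite and simple; the order of a graph is its number of vertices, and $\overline{G}$ denotes the complement of $G$. For a graph $G$, $d(u,v)$ is the length of a shortest $(u,v)$-path in $G$. A mapping $f:V(G)\to\{1,\ldots,k\}$ is a square $k$-coloring of $G$ if $f(u)\neq f(v)$ whenever $u\neq v$ and $d(u,v)\leqslant 2$. The square chromatic number $\chi_{\square}(G)$ is the minimum such $k$. The square graph $G^2$ is obtained from $G$ by adding an edge between every pair of vertices at distance 2 in $G$; thus $\chi_{\square}(G)=\chi(G^2)$, where $\chi$ is the ordinary chromatic number. Here $\overline{G}^2$ means the square of $\overline{G}$. -}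

module Defs where

open import Data.Nat using (ℕ; _<_)
open import Data.Fin using (Fin)
open import Data.Bool using (Bool; true; false; not)
open import Data.Product using (_×_; ∃; ∃-syntax; Σ-syntax)
open import Data.Sum using (_⊎_)
open import Relation.Binary.PropositionalEquality using (_≡_; _≢_)
open import Relation.Nullary using (¬_)

record Graph (n : ℕ) : Set where
  field
    adj   : Fin n → Fin n → Bool
    adj-sym : ∀ u v → adj u v ≡ adj v u
    adj-irrefl : ∀ u → adj u u ≡ false
open Graph public

Adj : ∀ {n} → Graph n → Fin n → Fin n → Set
Adj G u v = adj G u v ≡ true

complement : ∀ {n} → Graph n → Graph n
complement {n} G = record
  { adj = adjC
  ; adj-sym = symC
  ; adj-irrefl = irC }
  where
  open import Data.Fin using (_≟_)
  open import Relation.Nullary using (yes; no)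
  open import Relation.Binary.PropositionalEquality using (refl; cong) renaming (sym to ≡-sym)
  open import Data.Empty using (⊥-elim)
  adjC : Fin n → Fin n → Bool
  adjC u v with u ≟ v
  ... | yes _ = false
  ... | no  _ = not (adj G u v)
  symC : ∀ u v → adjC u v ≡ adjC v u
  symC u v with u ≟ v | v ≟ u
  ... | yes _ | yes _ = refl
  ... | yes p | no q = ⊥-elim (q (≡-sym p))
  ... | no p | yes q = ⊥-elim (p (≡-sym q))
  ... | no _ | no _ = cong not (adj-sym G u v)
  irC : ∀ u → adjC u u ≡ false
  irC u with u ≟ u
  ... | yes _ = refl
  ... | no p = ⊥-elim (p refl)

-- d(u,v) ≤ 2 for distinct u, v: there is a (u,v)-path of length 1 or 2,
-- i.e. u,v adjacent or they have a common neighbour.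
Dist≤2 : ∀ {n} → Graph n → Fin n → Fin n → Set
Dist≤2 G u v = Adj G u v ⊎ (∃[ w ] (Adj G u w × Adj G w v))

IsSquareColoring : ∀ {n} → Graph n → (k : ℕ) → (Fin n → Fin k) → Set
IsSquareColoring {n} G k f = ∀ (u v : Fin n) → u ≢ v → Dist≤2 G u v → f u ≢ f v

SquareColorable : ∀ {n} → Graph n → ℕ → Set
SquareColorable {n} G k = Σ[ f ∈ (Fin n → Fin k) ] IsSquareColoring G k f

IsSquareChromaticNumber : ∀ {n} → Graph n → ℕ → Set
IsSquareChromaticNumber G k =
  SquareColorable G k × (∀ j → j < k → ¬ SquareColorable G j)

-- An injective colouring is in particular a square colouring,
-- so the identity Fin n → Fin n square-colours every graph of order n; by
-- minimality χ□(G) ≤ n and χ□(Ḡ) ≤ n, and the bound follows by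
-- monotonicity of multiplication.
--
-- Any two distinct vertices are adjacent either in G or in Ḡ,
-- hence at distance ≤ 2 in one of them.  So if f square-colours G and g
-- square-colours Ḡ, the pair colouring u ↦ (f u, g u) is injective; coding
-- pairs in Fin (k₁ * k₂) via 'combine' gives an injection
-- Fin n → Fin (k₁ * k₂), whence n ≤ k₁ * k₂ by the pigeonhole principle.
module Submission where

open import Defs
open import Data.Nat using (ℕ; _≤_; _*_; _≤?_)
open import Data.Nat.Properties using (≰⇒>; *-mono-≤)
open import Data.Fin using (Fin; _≟_; combine)
open import Data.Fin.Properties using (injective⇒≤; combine-injective)
open import Data.Bool using (true; false)
open import Data.Product using (_×_; _,_; proj₁)
open import Data.Sum using (_⊎_; inj₁; inj₂)
open import Data.Empty using (⊥-elim)
open import Function using (id)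
open import Function.Definitions using (Injective)
open import Relation.Nullary using (yes; no; contradiction)
open import Relation.Binary.PropositionalEquality using (_≡_; _≢_; refl)

injective⇒squareColoring : ∀ {n k} (G : Graph n) (f : Fin n → Fin k) →
  Injective _≡_ _≡_ f → IsSquareColoring G k f
injective⇒squareColoring G f f-inj u v u≢v _ fu≡fv = u≢v (f-inj fu≡fv)

squareColorable-order : ∀ {n} (G : Graph n) → SquareColorable G n
squareColorable-order G = id , injective⇒squareColoring G id id

squareChromatic≤order : ∀ {n} (G : Graph n) (k : ℕ) →
  IsSquareChromaticNumber G k → k ≤ n
squareChromatic≤order {n} G k (_ , minimal) with k ≤? n
... | yes k≤n = k≤n
... | no  k≰n = contradiction (squareColorable-order G) (minimal n (≰⇒> k≰n))

adjacent-or-coadjacent : ∀ {n} (G : Graph n) (u v : Fin n) → u ≢ v →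
  Adj G u v ⊎ Adj (complement G) u v
adjacent-or-coadjacent G u v u≢v with u ≟ v | adj G u v in uv
... | yes u≡v | _     = ⊥-elim (u≢v u≡v)
... | no  _   | true  = inj₁ refl
... | no  _   | false rewrite uv = inj₂ refl

-- Square colourings of G and of its complement jointly separate all
-- vertices: equal colours in both would contradict whichever graph
-- contains the edge uv.
jointColoring-injective : ∀ {n k₁ k₂} (G : Graph n)
  (f : Fin n → Fin k₁) (g : Fin n → Fin k₂) →
  IsSquareColoring G k₁ f → IsSquareColoring (complement G) k₂ g →
  ∀ u v → f u ≡ f v → g u ≡ g v → u ≡ v
jointColoring-injective G f g f-col g-col u v fu≡fv gu≡gv with u ≟ v
... | yes u≡v = u≡v
... | no  u≢v with adjacent-or-coadjacent G u v u≢v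
...   | inj₁ uv∈G  = ⊥-elim (f-col u v u≢v (inj₁ uv∈G) fu≡fv)
...   | inj₂ uv∈Ḡ = ⊥-elim (g-col u v u≢v (inj₁ uv∈Ḡ) gu≡gv)

order≤product : ∀ {n} (G : Graph n) (k₁ k₂ : ℕ) →
  SquareColorable G k₁ → SquareColorable (complement G) k₂ → n ≤ k₁ * k₂
order≤product {n} G k₁ k₂ (f , f-col) (g , g-col) = injective⇒≤ pair-injective
  where
  pair : Fin n → Fin (k₁ * k₂)
  pair u = combine (f u) (g u)

  pair-injective : Injective _≡_ _≡_ pair
  pair-injective {u} {v} eq with combine-injective (f u) (g u) (f v) (g v) eq
  ... | fu≡fv , gu≡gv = jointColoring-injective G f g f-col g-col u v fu≡fv gu≡gv

theorem9 : ∀ (n : ℕ) (G : Graph n) (k₁ k₂ : ℕ) →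
    IsSquareChromaticNumber G k₁ →
    IsSquareChromaticNumber (complement G) k₂ →
    (n ≤ k₁ * k₂) × (k₁ * k₂ ≤ n * n)
theorem9 n G k₁ k₂ χ₁ χ₂ =
  order≤product G k₁ k₂ (proj₁ χ₁) (proj₁ χ₂) ,
  *-mono-≤ (squareChromatic≤order G k₁ χ₁)
           (squareChromatic≤order (complement G) k₂ χ₂)
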